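{- Let $G$ be a finite, simple, undirected graph of chromatic number $3$, and let $D$ be any orientation of $G$. Then there is a $3$-coloring $f$ of $G$ such that $D$ contains a directed full $f$-rainbow path, i.e. a directed path $v_1v_2v_3$ in $D$ (with arcs $(v_1,v_2)$ and $(v_2,v_3)$) such that $\{f(v_1),f(v_2),f(v_3)\}=\{1,2,3\}$.
   Context: A $3$-coloring of $G$ is a function $f:V(G)\to\{1,2,3\}$ with $f(u)\neq f(v)$ for all adjacent $u,v$. An orientation $D$ of $G$ is obtained by replacing each edge $uv$ by exactly one of the arcs $(u,v)$ or $(v,u)$. A directed full $f$-rainbow path is a directed path in $D$ of order $3$ whose three vertices receive pairwise distinct colors under $f$. -}

module Defs where

open import Data.Nat using (ℕ)
open import Data.Fin using (Fin)
open import Data.Bool using (Bool; true; false; _xor_)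
open import Data.Product using (Σ; _×_; ∃-syntax)
open import Relation.Binary.PropositionalEquality using (_≡_; _≢_)
open import Relation.Nullary using (¬_)

record Graph : Set where
  field
    n     : ℕ
    adj   : Fin n → Fin n → Bool
    sym   : ∀ u v → adj u v ≡ adj v u
    irref : ∀ v → adj v v ≡ false
open Graph public

Adj : (G : Graph) → Fin (n G) → Fin (n G) → Set
Adj G u v = adj G u v ≡ true

-- A proper k-coloring f : V(G) → Fin k (colors 1..k are encoded as Fin k).
IsColoring : (G : Graph) (k : ℕ) → (Fin (n G) → Fin k) → Set
IsColoring G k f = ∀ u v → Adj G u v → f u ≢ f v

Colorable : Graph → ℕ → Set
Colorable G k = ∃[ f ] IsColoring G k f

ChromaticNumber3 : Graph → Set
ChromaticNumber3 G = Colorable G 3 × ¬ Colorable G 2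

record Orientation (G : Graph) : Set where
  field
    arc      : Fin (n G) → Fin (n G) → Bool
    arc⊆edge : ∀ u v → arc u v ≡ true → Adj G u v
    oneWay   : ∀ u v → Adj G u v → (arc u v xor arc v u) ≡ true
open Orientation public

Arc : {G : Graph} → Orientation G → Fin (n G) → Fin (n G) → Set
Arc D u v = arc D u v ≡ true

DirectedFullRainbowPath : {G : Graph} → Orientation G → (Fin (n G) → Fin 3) → Set
DirectedFullRainbowPath {G} D f =
  Σ (Fin (n G)) λ v₁ → Σ (Fin (n G)) λ v₂ → Σ (Fin (n G)) λ v₃ →
    (v₁ ≢ v₂ × v₂ ≢ v₃ × v₁ ≢ v₃) ×
    (Arc D v₁ v₂ × Arc D v₂ v₃) ×
    (f v₁ ≢ f v₂ × f v₂ ≢ f v₃ × f v₁ ≢ f v₃)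

-- Call a vertex transit if it has both an in- and an out-neighbour.  If some arc
-- x → y joins two transit vertices, take t → x → y → z and any 3-colouring f:
-- either two neighbours p → x → q of x already get different colours, or every
-- neighbour of x has the colour of y, and recolouring x with the colour missing
-- from {f y, f z} makes x → y → z rainbow.  Otherwise colour sources 0, transit
-- vertices 1 and the remaining vertices 2; no arc joins two transit vertices, so
-- this is proper, and a transit vertex t → x → w gives the rainbow path (t is a
-- source, w is not transit).  Without transit vertices every arc runs from a
-- source to a non-source, which would 2-colour G.
module Submission where

open import Defs
open import Data.Bool using (true; false; if_then_else_; _xor_)
open import Data.Bool.Properties using (_≟_)
open import Data.Fin using (Fin; zero; suc)
open import Data.Fin.Properties using (any?) renaming (_≟_ to _≟ᶠ_)
open import Data.Product using (Σ; _×_; _,_; ∃; ∃-syntax)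
open import Data.Sum using (_⊎_; inj₁; inj₂)
open import Data.Vec.Functional using (updateAt)
open import Data.Vec.Functional.Properties using (updateAt-updates; updateAt-minimal)
open import Function using (const)
open import Relation.Nullary using (¬_; Dec; yes; no; does; contradiction)
open import Relation.Nullary.Decidable using (_×-dec_; ¬?; dec-true; dec-false)
open import Relation.Binary.PropositionalEquality
  using (_≡_; _≢_; refl; trans; ≢-sym) renaming (sym to ≡-sym)

fresh-colour : (a b : Fin 3) → ∃[ c ] c ≢ a × c ≢ b
fresh-colour zero             zero             = suc zero , (λ ()) , (λ ())
fresh-colour zero             (suc zero)       = suc (suc zero) , (λ ()) , (λ ())
fresh-colour zero             (suc (suc zero)) = suc zero , (λ ()) , (λ ())
fresh-colour (suc zero)       zero             = suc (suc zero) , (λ ()) , (λ ())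
fresh-colour (suc zero)       (suc zero)       = zero , (λ ()) , (λ ())
fresh-colour (suc zero)       (suc (suc zero)) = zero , (λ ()) , (λ ())
fresh-colour (suc (suc zero)) zero             = suc zero , (λ ()) , (λ ())
fresh-colour (suc (suc zero)) (suc zero)       = zero , (λ ()) , (λ ())
fresh-colour (suc (suc zero)) (suc (suc zero)) = zero , (λ ()) , (λ ())

≢-resp : ∀ {A : Set} {a a′ b b′ : A} → a ≡ a′ → b ≡ b′ → a′ ≢ b′ → a ≢ b
≢-resp refl refl a′≢b′ = a′≢b′

xor-true : ∀ {a b} → a xor b ≡ true → a ≡ true ⊎ b ≡ true
xor-true {true}          _ = inj₁ refl
xor-true {false} {true}  _ = inj₂ refl

module _ (G : Graph) where

  private
    V = Fin (n G)

  Adj-irreflexive : ∀ {v} → ¬ Adj G v v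
  Adj-irreflexive {v} e with trans (≡-sym (irref G v)) e
  ... | ()

  Adj-sym : ∀ {u v} → Adj G u v → Adj G v u
  Adj-sym {u} {v} = trans (Graph.sym G v u)

  IsColoring-updateAt : ∀ {k} {f : V → Fin k} → IsColoring G k f →
    ∀ x c → (∀ v → Adj G x v → f v ≢ c) → IsColoring G k (updateAt f x (const c))
  IsColoring-updateAt {k} {f} proper x c avoid = proper′
    where
    f′ : V → Fin k
    f′ = updateAt f x (const c)

    updated : f′ x ≡ c
    updated = updateAt-updates x f

    unchanged : ∀ {w} → w ≢ x → f′ w ≡ f w
    unchanged {w} = updateAt-minimal w x f

    proper′ : IsColoring G k f′
    proper′ u v e with u ≟ᶠ x | v ≟ᶠ x
    ... | yes refl | yes refl = contradiction e Adj-irreflexive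
    ... | yes refl | no v≢x   = ≢-resp updated (unchanged v≢x) (≢-sym (avoid v e))
    ... | no u≢x   | yes refl = ≢-resp (unchanged u≢x) updated (avoid u (Adj-sym e))
    ... | no u≢x   | no v≢x   = ≢-resp (unchanged u≢x) (unchanged v≢x) (proper u v e)

module _ {G : Graph} (D : Orientation G) where

  private
    V = Fin (n G)

  RainbowColouring : Set
  RainbowColouring = Σ (V → Fin 3) λ f → IsColoring G 3 f × DirectedFullRainbowPath D f

  Arc-irreflexive : ∀ {v} → ¬ Arc D v v
  Arc-irreflexive {v} a = Adj-irreflexive G (arc⊆edge D v v a)

  Arc-asym : ∀ {u v} → Arc D u v → ¬ Arc D v u
  Arc-asym {u} {v} uv vu with oneWay D u v (arc⊆edge D u v uv)
  ... | xor≡true rewrite uv | vu = contradiction xor≡true λ ()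

  Arc⇒≢ : ∀ {u v} → Arc D u v → u ≢ v
  Arc⇒≢ a refl = Arc-irreflexive a

  Adj⇒Arc : ∀ {u v} → Adj G u v → Arc D u v ⊎ Arc D v u
  Adj⇒Arc {u} {v} e = xor-true (oneWay D u v e)

  Arc? : ∀ u v → Dec (Arc D u v)
  Arc? u v = arc D u v ≟ true

  arcwise⇒IsColoring : ∀ {k} {f : V → Fin k} →
    (∀ u v → Arc D u v → f u ≢ f v) → IsColoring G k f
  arcwise⇒IsColoring proper u v e with Adj⇒Arc e
  ... | inj₁ uv = proper u v uv
  ... | inj₂ vu = ≢-sym (proper v u vu)

  rainbow-path : ∀ {f : V → Fin 3} → IsColoring G 3 f → ∀ {t x w} →
    Arc D t x → Arc D x w → f t ≢ f w → DirectedFullRainbowPath D f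
  rainbow-path {f} proper {t} {x} {w} tx xw ft≢fw =
    t , x , w ,
    (Arc⇒≢ tx , Arc⇒≢ xw , λ { refl → Arc-asym tx xw }) ,
    (tx , xw) ,
    (proper t x (arc⊆edge D t x tx) , proper x w (arc⊆edge D x w xw) , ft≢fw)

  HasIn HasOut Transit : V → Set
  HasIn x = ∃ λ t → Arc D t x
  HasOut x = ∃ λ w → Arc D x w
  Transit x = HasIn x × HasOut x

  HasIn? : ∀ x → Dec (HasIn x)
  HasIn? x = any? λ t → Arc? t x

  HasOut? : ∀ x → Dec (HasOut x)
  HasOut? x = any? λ w → Arc? x w

  Transit? : ∀ x → Dec (Transit x)
  Transit? x = HasIn? x ×-dec HasOut? x

  TransitArc : Set
  TransitArc = ∃ λ x → ∃ λ y → Arc D x y × Transit x × Transit y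

  TransitArc? : Dec TransitArc
  TransitArc? = any? λ x → any? λ y → Arc? x y ×-dec Transit? x ×-dec Transit? y

  rainbow-by-recolouring : ∀ {f : V → Fin 3} → IsColoring G 3 f → ∀ {x y z} →
    HasIn x → Arc D x y → Arc D y z → RainbowColouring
  rainbow-by-recolouring {f} proper {x} {y} {z} (t , tx) xy yz
    with any? (λ p → any? λ q → Arc? p x ×-dec Arc? x q ×-dec ¬? (f p ≟ᶠ f q))
       | fresh-colour (f y) (f z)
  ... | yes (p , q , px , xq , fp≢fq) | _ = f , proper , rainbow-path proper px xq fp≢fq
  ... | no none | c , c≢fy , c≢fz = f′ , proper′ , rainbow-path proper′ xy yz f′x≢f′z
    where
    across : ∀ {p q} → Arc D p x → Arc D x q → f p ≡ f q
    across {p} {q} px xq with f p ≟ᶠ f q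
    ... | yes fp≡fq = fp≡fq
    ... | no fp≢fq = contradiction (p , q , px , xq , fp≢fq) none

    neighbour-colour : ∀ v → Adj G x v → f v ≡ f y
    neighbour-colour v e with Adj⇒Arc e
    ... | inj₁ xv = trans (≡-sym (across tx xv)) (across tx xy)
    ... | inj₂ vx = across vx xy

    f′ : V → Fin 3
    f′ = updateAt f x (const c)

    proper′ : IsColoring G 3 f′
    proper′ = IsColoring-updateAt G proper x c λ v e →
      ≢-resp (neighbour-colour v e) refl (≢-sym c≢fy)

    f′x≢f′z : f′ x ≢ f′ z
    f′x≢f′z = ≢-resp (updateAt-updates x f)
                     (updateAt-minimal z x f λ { refl → Arc-asym xy yz })
                     c≢fz

  roleColour : V → Fin 3
  roleColour x = if does (HasIn? x) then (if does (HasOut? x) then suc zero else suc (suc zero)) else zero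

  roleColour-source : ∀ {x} → ¬ HasIn x → roleColour x ≡ zero
  roleColour-source {x} ¬inX rewrite dec-false (HasIn? x) ¬inX = refl

  roleColour-transit : ∀ {x} → Transit x → roleColour x ≡ suc zero
  roleColour-transit {x} (inX , outX) rewrite dec-true (HasIn? x) inX | dec-true (HasOut? x) outX = refl

  roleColour-sink : ∀ {x} → HasIn x → ¬ HasOut x → roleColour x ≡ suc (suc zero)
  roleColour-sink {x} inX ¬outX rewrite dec-true (HasIn? x) inX | dec-false (HasOut? x) ¬outX = refl

  roleColour-proper : ¬ TransitArc → IsColoring G 3 roleColour
  roleColour-proper ¬transitArc = arcwise⇒IsColoring roleColour-arc
    where
    roleColour-arc : ∀ u v → Arc D u v → roleColour u ≢ roleColour v
    roleColour-arc u v uv = by-cases (HasIn? u) (HasOut? v)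
      where
      by-cases : Dec (HasIn u) → Dec (HasOut v) → roleColour u ≢ roleColour v
      by-cases (yes inU) (yes outV) =
        contradiction (u , v , uv , (inU , v , uv) , (u , uv) , outV) ¬transitArc
      by-cases (yes inU) (no ¬outV) =
        ≢-resp (roleColour-transit (inU , v , uv)) (roleColour-sink (u , uv) ¬outV) λ ()
      by-cases (no ¬inU) (yes outV) =
        ≢-resp (roleColour-source ¬inU) (roleColour-transit ((u , uv) , outV)) λ ()
      by-cases (no ¬inU) (no ¬outV) =
        ≢-resp (roleColour-source ¬inU) (roleColour-sink (u , uv) ¬outV) λ ()

  no-transit⇒2-colourable : (∀ x → ¬ Transit x) → Colorable G 2
  no-transit⇒2-colourable ¬transit = hasInColour , arcwise⇒IsColoring hasInColour-arc
    where
    hasInColour : V → Fin 2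
    hasInColour x = if does (HasIn? x) then suc zero else zero

    hasInColour-arc : ∀ u v → Arc D u v → hasInColour u ≢ hasInColour v
    hasInColour-arc u v uv
      rewrite dec-false (HasIn? u) (λ inU → ¬transit u (inU , v , uv))
            | dec-true (HasIn? v) (u , uv) = λ ()

  rainbow-by-roles : ¬ Colorable G 2 → ¬ TransitArc → RainbowColouring
  rainbow-by-roles ¬2-colourable ¬transitArc with any? Transit?
  ... | no ¬transit = contradiction (no-transit⇒2-colourable λ x t → ¬transit (x , t)) ¬2-colourable
  ... | yes (x , transitX@((t , tx) , w , xw)) =
    roleColour , proper , rainbow-path proper tx xw roleColour-t≢w
    where
    proper = roleColour-proper ¬transitArc

    roleColour-t≢w : roleColour t ≢ roleColour w
    roleColour-t≢w =
      ≢-resp (roleColour-source λ inT → ¬transitArc (t , x , tx , (inT , x , tx) , transitX))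
             (roleColour-sink (x , xw) λ outW → ¬transitArc (x , w , xw , transitX , (x , xw) , outW))
             λ ()

theorem4 : (G : Graph) → ChromaticNumber3 G → (D : Orientation G) →
    Σ (Fin (n G) → Fin 3) λ f → IsColoring G 3 f × DirectedFullRainbowPath D f
theorem4 G ((f , proper) , ¬2-colourable) D with TransitArc? D
... | yes (x , y , xy , (inX , _) , (_ , z , yz)) = rainbow-by-recolouring D proper inX xy yz
... | no ¬transitArc = rainbow-by-roles D ¬2-colourable ¬transitArc
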